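{- Let $T=(t_i)_{i\le n}$, $t_i=(x_i,y_i)$, be an Erdős–Szekeres tableau. Define a relation $R$ on $[n]$ by: $i\,R\,j$ whenever $t_i$ hooks $t_j$, and $j\,R\,i$ whenever $t_i$ slices $t_j$. Then the strict order $<_{P(T)}$ of the order poset equals the transitive closure of $R$.
   Context: For a sequence $A=(a_1,\dots,a_n)$ of distinct real numbers, $a_i^+$ (resp. $a_i^-$) is the length of the longest increasing (resp. decreasing) subsequence of $A$ ending at $a_i$; the EST of $A$ is $T(A)=((a_i^+,a_i^-))_{i\le n}$. For $m\le n$, $T_m=(t_1,\dots,t_m)$, regarded also as a set of points. For a point $(x,y)$: $\mathrm{Col}(x,y)=\{(x,y'): y'>y\}$ and $\mathrm{Row}(x,y)=\{(x',y): x'>x\}$. For $i<j$: $t_i$ hooks $t_j$ if there is an integer $x$ with $x_i\le x\le x_j$ and $\mathrm{Col}(x,y_i)\cap T_j=\emptyset$; $t_i$ slices $t_j$ if there is an integer $y$ with $y_i\le y\le y_j$ and $\mathrm{Row}(x_i,y)\cap T_j=\emptyset$. A sequence $A$ is identified with the linear order $i<_A j$ iff $a_i<a_j$ on $[n]$; $[T]$ is the set of such orders with $T(A)=T$; the order poset $P(T)$ on $[n]$ has $i<_{P(T)}j$ iff $i<_A j$ for all $A\in[T]$. -}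

module Defs where

open import Data.Nat using (ℕ; zero; suc; _≤_; _<_)
open import Data.Fin using (Fin; toℕ)
open import Data.Product using (_×_; _,_; proj₁; proj₂; ∃; ∃-syntax)
open import Relation.Binary.PropositionalEquality using (_≡_)
open import Relation.Nullary using (¬_)
open import Function.Definitions using (Injective)

-- A finite sequence A = (a_1,…,a_n) (indices 0-based as Fin n).
-- Values are natural numbers; only the relative order of the values
-- matters for every notion below, and every sequence of distinct reals
-- has the order type of a sequence of distinct naturals.
Seq : ℕ → Set
Seq n = Fin n → ℕ

Distinct : ∀ {n} → Seq n → Set
Distinct A = Injective _≡_ _≡_ A

_<ᶠ_ : ∀ {n} → Fin n → Fin n → Set
i <ᶠ j = toℕ i < toℕ j

_≤ᶠ_ : ∀ {n} → Fin n → Fin n → Set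
i ≤ᶠ j = toℕ i ≤ toℕ j

data IncSub {n} (A : Seq n) : Fin n → ℕ → Set where
  single : ∀ i → IncSub A i 1
  extend : ∀ {j i k} → j <ᶠ i → A j < A i → IncSub A j k → IncSub A i (suc k)

data DecSub {n} (A : Seq n) : Fin n → ℕ → Set where
  single : ∀ i → DecSub A i 1
  extend : ∀ {j i k} → j <ᶠ i → A i < A j → DecSub A j k → DecSub A i (suc k)

LongestInc : ∀ {n} → Seq n → Fin n → ℕ → Set
LongestInc A i k = IncSub A i k × (∀ m → IncSub A i m → m ≤ k)

LongestDec : ∀ {n} → Seq n → Fin n → ℕ → Set
LongestDec A i k = DecSub A i k × (∀ m → DecSub A i m → m ≤ k)

Tableau : ℕ → Set
Tableau n = Fin n → ℕ × ℕ

xc : ∀ {n} → Tableau n → Fin n → ℕ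
xc T i = proj₁ (T i)

yc : ∀ {n} → Tableau n → Fin n → ℕ
yc T i = proj₂ (T i)

HasEST : ∀ {n} → Seq n → Tableau n → Set
HasEST A T = ∀ i → LongestInc A i (xc T i) × LongestDec A i (yc T i)

IsESTableau : ∀ {n} → Tableau n → Set
IsESTableau {n} T = ∃[ A ] (Distinct A × HasEST A T)

ColEmpty : ∀ {n} → Tableau n → ℕ → ℕ → Fin n → Set
ColEmpty T x y j = ∀ k → k ≤ᶠ j → ¬ (xc T k ≡ x × y < yc T k)

RowEmpty : ∀ {n} → Tableau n → ℕ → ℕ → Fin n → Set
RowEmpty T x y j = ∀ k → k ≤ᶠ j → ¬ (yc T k ≡ y × x < xc T k)

Hooks : ∀ {n} → Tableau n → Fin n → Fin n → Set
Hooks T i j = i <ᶠ j × ∃[ x ] (xc T i ≤ x × x ≤ xc T j × ColEmpty T x (yc T i) j)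

Slices : ∀ {n} → Tableau n → Fin n → Fin n → Set
Slices T i j = i <ᶠ j × ∃[ y ] (yc T i ≤ y × y ≤ yc T j × RowEmpty T (xc T i) y j)

data R {n} (T : Tableau n) : Fin n → Fin n → Set where
  hook  : ∀ {i j} → Hooks T i j → R T i j
  slice : ∀ {i j} → Slices T i j → R T j i

OrderP : ∀ {n} → Tableau n → Fin n → Fin n → Set
OrderP T i j = ∀ A → Distinct A → HasEST A T → A i < A j

-- Let T = T(A₀) and let R be the hook/slice relation.  Two facts drive the proof.
--
--  * Soundness: every A realising T satisfies A a < A b whenever a R b.  Hence
--    a path of R-steps from i to j forces a_i < a_j in every A ∈ [T].
--  * Completeness: every A with A a < A b for all a R b realises T.
--    (Each t_j with x_j ≥ 2 is hooked by some earlier t_k with x_k = x_j − 1,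
--    and each earlier t_k with x_k ≥ x_j slices t_j; dually for rows.)
--
-- Given i <_{P(T)} j, raise A₀ by a constant on the set U of points reachable
-- from i; the result still respects R, so it realises T.  If j ∉ U it would put
-- a_j below a_i, so j ∈ U, i.e. there is an R-path from i to j.
--
-- Every statement about x-coordinates and hooks is proved once, for an arbitrary
-- strict total order on the values; its y/slice counterpart is the same statement
-- for the reversed order and the mirrored tableau (x and y swapped), in which
-- slices are literally hooks.

module Submission where

open import Defs
open import Data.Nat using (ℕ; zero; suc; _+_; _≤_; _<_; s≤s; s≤s⁻¹; _≤?_; _<?_)
open import Data.Nat.Properties
open import Data.Nat.Induction using (<-wellFounded)
open import Data.Fin using (Fin; toℕ; _>_) renaming (_≟_ to _≟ᶠ_)
open import Data.Fin.Properties using (any?; toℕ-injective)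
open import Data.Fin.Induction using (>-wellFounded) renaming (<-wellFounded to <ᶠ-wellFounded)
open import Data.List using (tabulate)
open import Data.List.Extrema.Nat using (max; xs≤max)
open import Data.List.Membership.Propositional.Properties using (∈-tabulate⁺)
open import Data.List.Relation.Unary.All using (lookup)
open import Data.Product using (_×_; _,_; proj₁; proj₂; ∃-syntax; swap)
open import Data.Sum using (_⊎_; inj₁; inj₂)
open import Data.Empty using (⊥-elim)
open import Function using (_∘_; flip)
open import Function.Bundles using (_⇔_; mk⇔)
open import Induction.WellFounded using (Acc; acc)
open import Level using (0ℓ)
open import Relation.Binary using (Rel; Decidable; IsStrictTotalOrder; tri<; tri≈; tri>)
open import Relation.Binary.Construct.Closure.ReflexiveTransitive using (Star; ε; _◅_)
open import Relation.Binary.Construct.Closure.Transitive using (TransClosure; [_]; _∷_; _∷ʳ_)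
import Relation.Binary.Construct.Flip.EqAndOrd as Flip
open import Relation.Binary.PropositionalEquality using (_≡_; refl; sym; trans; cong; subst)
open import Relation.Nullary using (¬_; Dec; yes; no; map′; ¬?)
open import Relation.Nullary.Decidable using (_×-dec_)

≤ᶠ-split : ∀ {n} {k j : Fin n} → k ≤ᶠ j → k <ᶠ j ⊎ k ≡ j
≤ᶠ-split k≤j with m≤n⇒m<n∨m≡n k≤j
... | inj₁ k<j = inj₁ k<j
... | inj₂ k≡j = inj₂ (toℕ-injective k≡j)

data Chain (_⊏_ : Rel ℕ 0ℓ) {n} (A : Seq n) : Fin n → ℕ → Set where
  single : ∀ i → Chain _⊏_ A i 1
  extend : ∀ {j i k} → j <ᶠ i → A j ⊏ A i → Chain _⊏_ A j k → Chain _⊏_ A i (suc k)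

Longest : (_⊏_ : Rel ℕ 0ℓ) → ∀ {n} → Seq n → Fin n → ℕ → Set
Longest _⊏_ A i k = Chain _⊏_ A i k × (∀ m → Chain _⊏_ A i m → m ≤ k)

Realises : (_⊏_ : Rel ℕ 0ℓ) → ∀ {n} → Seq n → Tableau n → Set
Realises _⊏_ A T = ∀ i → Longest _⊏_ A i (xc T i) × Longest (flip _⊏_) A i (yc T i)

inc⇒chain : ∀ {n} {A : Seq n} {i k} → IncSub A i k → Chain _<_ A i k
inc⇒chain (single i) = single i
inc⇒chain (extend j<i lt s) = extend j<i lt (inc⇒chain s)

chain⇒inc : ∀ {n} {A : Seq n} {i k} → Chain _<_ A i k → IncSub A i k
chain⇒inc (single i) = single i
chain⇒inc (extend j<i lt s) = extend j<i lt (chain⇒inc s)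

dec⇒chain : ∀ {n} {A : Seq n} {i k} → DecSub A i k → Chain (flip _<_) A i k
dec⇒chain (single i) = single i
dec⇒chain (extend j<i lt s) = extend j<i lt (dec⇒chain s)

chain⇒dec : ∀ {n} {A : Seq n} {i k} → Chain (flip _<_) A i k → DecSub A i k
chain⇒dec (single i) = single i
chain⇒dec (extend j<i lt s) = extend j<i lt (chain⇒dec s)

hasEST⇒realises : ∀ {n} {A : Seq n} {T} → HasEST A T → Realises _<_ A T
hasEST⇒realises est i with est i
... | (inc , inc-max) , (dec , dec-max) =
  (inc⇒chain inc , λ m → inc-max m ∘ chain⇒inc) , (dec⇒chain dec , λ m → dec-max m ∘ chain⇒dec)

realises⇒hasEST : ∀ {n} {A : Seq n} {T} → Realises _<_ A T → HasEST A T
realises⇒hasEST real i with real i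
... | (inc , inc-max) , (dec , dec-max) =
  (chain⇒inc inc , λ m → inc-max m ∘ inc⇒chain) , (chain⇒dec dec , λ m → dec-max m ∘ dec⇒chain)

-- Swapping coordinates turns slices into hooks: Slices T i j is, by definition,
-- Hooks (mirror T) i j, and mirror (mirror T) = T.
mirror : ∀ {n} → Tableau n → Tableau n
mirror T = swap ∘ T

realises-mirror : ∀ {_⊏_ : Rel ℕ 0ℓ} {n} {A : Seq n} {T} → Realises _⊏_ A T → Realises (flip _⊏_) A (mirror T)
realises-mirror real = swap ∘ real

respects-mirror : ∀ {_⊏_ : Rel ℕ 0ℓ} {n} {A : Seq n} {T} →
  (∀ {a b} → R T a b → A a ⊏ A b) → ∀ {a b} → R (mirror T) a b → flip _⊏_ (A a) (A b)
respects-mirror respects (hook h)  = respects (slice h)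
respects-mirror respects (slice s) = respects (hook s)

-- Decidability of hooks: column emptiness is a search over T_j, and the hooking
-- column ranges over a finite interval.  (Needed to decide reachability along R.)

module Decide {n} (T : Tableau n) where

  Blocker : ℕ → ℕ → Fin n → Set
  Blocker c d j = ∃[ m ] (m ≤ᶠ j × xc T m ≡ c × d < yc T m)

  blocker? : ∀ c d j → Dec (Blocker c d j)
  blocker? c d j = any? λ m → (toℕ m ≤? toℕ j) ×-dec (xc T m ≟ c) ×-dec (d <? yc T m)

  unblocked⇒empty : ∀ {c d j} → ¬ Blocker c d j → ColEmpty T c d j
  unblocked⇒empty free m m≤j (x≡c , d<y) = free (m , m≤j , x≡c , d<y)

  colEmpty? : ∀ c d j → Dec (ColEmpty T c d j)
  colEmpty? c d j = map′ unblocked⇒empty (λ empty (m , m≤j , x≡c , d<y) → empty m m≤j (x≡c , d<y))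
                         (¬? (blocker? c d j))

  hooks? : ∀ a b → Dec (Hooks T a b)
  hooks? a b = (toℕ a <? toℕ b) ×-dec map′ bounded⇒column column⇒bounded
                                          (anyUpTo? hookColumn? (suc (xc T b)))
    where
      HookColumn : ℕ → Set
      HookColumn c = xc T a ≤ c × ColEmpty T c (yc T a) b

      hookColumn? : ∀ c → Dec (HookColumn c)
      hookColumn? c = (xc T a ≤? c) ×-dec colEmpty? c (yc T a) b

      bounded⇒column : ∃[ c ] (c < suc (xc T b) × HookColumn c) →
                       ∃[ c ] (xc T a ≤ c × c ≤ xc T b × ColEmpty T c (yc T a) b)
      bounded⇒column (c , c<b , a≤c , empty) = c , a≤c , s≤s⁻¹ c<b , empty

      column⇒bounded : ∃[ c ] (xc T a ≤ c × c ≤ xc T b × ColEmpty T c (yc T a) b) →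
                       ∃[ c ] (c < suc (xc T b) × HookColumn c)
      column⇒bounded (c , a≤c , c≤b , empty) = c , s≤s c≤b , a≤c , empty

R? : ∀ {n} (T : Tableau n) → Decidable (R T)
R? T a b with Decide.hooks? T a b | Decide.hooks? (mirror T) b a
... | yes h | _     = yes (hook h)
... | no _  | yes s = yes (slice s)
... | no ¬h | no ¬s = no λ { (hook h) → ¬h h ; (slice s) → ¬s s }

module Realisation {_⊏_ : Rel ℕ 0ℓ} (order : IsStrictTotalOrder _≡_ _⊏_)
                   {n} (T : Tableau n) (A : Seq n) (injective : Distinct A)
                   (real : Realises _⊏_ A T) where
  open IsStrictTotalOrder order using (compare) renaming (irrefl to ⊏-irrefl; trans to ⊏-trans)
  open Decide T using (blocker?; unblocked⇒empty)

  x y : Fin n → ℕ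
  x = xc T
  y = yc T

  longest-x : ∀ k → Chain _⊏_ A k (x k)
  longest-x k = proj₁ (proj₁ (real k))

  x-max : ∀ {k m} → Chain _⊏_ A k m → m ≤ x k
  x-max {k} = proj₂ (proj₁ (real k)) _

  y-max : ∀ {k m} → Chain (flip _⊏_) A k m → m ≤ y k
  y-max {k} = proj₂ (proj₂ (real k)) _

  x-positive : ∀ k → 1 ≤ x k
  x-positive k = x-max (single k)

  x-grows : ∀ {k j} → k <ᶠ j → A k ⊏ A j → x k < x j
  x-grows {k} k<j up = x-max (extend k<j up (longest-x k))

  y-grows : ∀ {k j} → k <ᶠ j → A j ⊏ A k → y k < y j
  y-grows {k} k<j down = y-max (extend k<j down (proj₁ (proj₂ (real k))))

  order-of : ∀ {k j} → k <ᶠ j → A k ⊏ A j ⊎ A j ⊏ A k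
  order-of {k} {j} k<j with compare (A k) (A j)
  ... | tri< up _ _     = inj₁ up
  ... | tri≈ _ same _   = ⊥-elim (<-irrefl (cong toℕ (injective same)) k<j)
  ... | tri> _ _ down   = inj₂ down

  same-x : ∀ {k j} → k <ᶠ j → x k ≡ x j → A j ⊏ A k
  same-x k<j same with order-of k<j
  ... | inj₁ up   = ⊥-elim (<-irrefl same (x-grows k<j up))
  ... | inj₂ down = down

  same-y : ∀ {k j} → k <ᶠ j → y k ≡ y j → A k ⊏ A j
  same-y k<j same with order-of k<j
  ... | inj₁ up   = up
  ... | inj₂ down = ⊥-elim (<-irrefl same (y-grows k<j down))

  x-drop⇒down : ∀ {k j} → k <ᶠ j → x j ≤ x k → A j ⊏ A k
  x-drop⇒down k<j drop with order-of k<j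
  ... | inj₁ up   = ⊥-elim (<⇒≱ (x-grows k<j up) drop)
  ... | inj₂ down = down

  above⇒later : ∀ {k m} → x m ≡ x k → y k < y m → k <ᶠ m
  above⇒later {k} {m} same above with <-cmp (toℕ m) (toℕ k)
  ... | tri< m<k _ _ = ⊥-elim (<-asym above (y-grows m<k (same-x m<k same)))
  ... | tri≈ _ m≡k _ = ⊥-elim (<-irrefl (cong y (toℕ-injective (sym m≡k))) above)
  ... | tri> _ _ k<m = k<m

  levels : ∀ {b m} → Chain _⊏_ A b m → m ≡ x b → ∀ {c v} → 1 ≤ c → c ≤ m → A b ⊏ v →
           ∃[ k ] (k ≤ᶠ b × x k ≡ c × A k ⊏ v)
  levels (single b) len 1≤c c≤1 below =
    b , ≤-refl , trans (sym len) (sym (≤-antisym c≤1 1≤c)) , below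
  levels {b} {suc m} (extend {j} j<b up chain) len {c} 1≤c c≤m below with c ≟ suc m
  ... | yes c≡ = b , ≤-refl , trans (sym len) (sym c≡) , below
  ... | no c≢ with levels chain m≡xj 1≤c (s≤s⁻¹ (≤∧≢⇒< c≤m c≢)) (⊏-trans up below)
    where
      m≡xj : m ≡ x j
      m≡xj = ≤-antisym (x-max chain) (s≤s⁻¹ (subst (x j <_) (sym len) (x-grows j<b up)))
  ... | k , k≤j , xk≡c , k-below = k , ≤-trans k≤j (<⇒≤ j<b) , xk≡c , k-below

  hooks-increase : ∀ {a b} → Hooks T a b → A a ⊏ A b
  hooks-increase {a} {b} (a<b , c , xa≤c , c≤xb , empty) with order-of a<b
  ... | inj₁ up = up
  ... | inj₂ down with levels (longest-x b) refl (≤-trans (x-positive a) xa≤c) c≤xb down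
  ... | k , k≤b , xk≡c , k-below with <-cmp (toℕ k) (toℕ a)
  ... | tri< k<a _ _ = ⊥-elim (<⇒≱ (x-grows k<a k-below) (subst (x a ≤_) (sym xk≡c) xa≤c))
  ... | tri≈ _ k≡a _ = ⊥-elim (⊏-irrefl (cong A (toℕ-injective k≡a)) k-below)
  ... | tri> _ _ a<k = ⊥-elim (empty k k≤b (xk≡c , y-grows a<k k-below))

  x-drop⇒slices : ∀ {k j} → k <ᶠ j → x j ≤ x k → Slices T k j
  x-drop⇒slices {k} {j} k<j drop =
    k<j , y j , <⇒≤ (y-grows k<j (x-drop⇒down k<j drop)) , ≤-refl , row-empty
    where
      row-empty : RowEmpty T (x k) (y j) j
      row-empty m m≤j (ym≡yj , xk<xm) with ≤ᶠ-split m≤j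
      ... | inj₁ m<j = <⇒≱ (<-≤-trans (x-grows m<j (same-y m<j ym≡yj)) drop) (<⇒≤ xk<xm)
      ... | inj₂ refl = <⇒≱ xk<xm drop

  -- If k < j and a_k ⊏ a_j, some point of column x_k before j hooks t_j: either
  -- the column is empty above t_k within T_j, or a point m above t_k in it has
  -- k < m < j and a_m ⊏ a_k ⊏ a_j, and we recurse on m (well founded towards j).
  hook-in-column : ∀ {j k} → Acc _>_ k → k <ᶠ j → A k ⊏ A j →
                   ∃[ k′ ] (k′ <ᶠ j × x k′ ≡ x k × Hooks T k′ j)
  hook-in-column {j} {k} (acc later) k<j up with blocker? (x k) (y k) j
  ... | no free = k , k<j , refl , (k<j , x k , ≤-refl , <⇒≤ (x-grows k<j up) , unblocked⇒empty free)
  ... | yes (m , m≤j , xm≡xk , yk<ym) with ≤ᶠ-split m≤j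
  ...   | inj₂ refl = ⊥-elim (<-irrefl (sym xm≡xk) (x-grows k<j up))
  ...   | inj₁ m<j with hook-in-column (later k<m) m<j (⊏-trans (same-x k<m (sym xm≡xk)) up)
    where k<m = above⇒later xm≡xk yk<ym
  ...     | k′ , k′<j , xk′≡xm , h = k′ , k′<j , trans xk′≡xm xm≡xk , h

  hook-predecessor : ∀ j {m} → x j ≡ suc (suc m) → ∃[ k ] (k <ᶠ j × x k ≡ suc m × Hooks T k j)
  hook-predecessor j {m} len with subst (Chain _⊏_ A j) len (longest-x j)
  ... | extend {k₀} k₀<j up chain with hook-in-column (>-wellFounded k₀) k₀<j up
  ... | k , k<j , xk≡xk₀ , h = k , k<j , trans xk≡xk₀ xk₀≡ , h
    where
      xk₀≡ : x k₀ ≡ suc m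
      xk₀≡ = ≤-antisym (s≤s⁻¹ (subst (x k₀ <_) len (x-grows k₀<j up))) (x-max chain)

R-increases : ∀ {_⊏_ : Rel ℕ 0ℓ} (order : IsStrictTotalOrder _≡_ _⊏_) {n} {T : Tableau n} {A : Seq n} →
              Distinct A → Realises _⊏_ A T → ∀ {a b} → R T a b → A a ⊏ A b
R-increases order {T = T} {A} injective real (hook h) =
  Realisation.hooks-increase order T A injective real h
R-increases order {T = T} {A} injective real (slice s) =
  Realisation.hooks-increase (Flip.isStrictTotalOrder order) (mirror T) A injective (realises-mirror real) s

module Extension {_⊏_ : Rel ℕ 0ℓ} (order : IsStrictTotalOrder _≡_ _⊏_)
                 {n} (T : Tableau n) (A₀ : Seq n) (injective₀ : Distinct A₀)
                 (real₀ : Realises _⊏_ A₀ T)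
                 (A : Seq n) (respects : ∀ {a b} → R T a b → A a ⊏ A b) where
  open IsStrictTotalOrder order using (asym)
  open Realisation order T A₀ injective₀ real₀
    using (x; x-positive; hook-predecessor; x-drop⇒slices)

  longest-chain : ∀ j → Acc _<ᶠ_ j → Longest _⊏_ A j (x j)
  longest-chain j (acc earlier) = reach (x j) refl , bounded
    where
      -- The hook predecessor of t_j extends a longest chain by one step.
      reach : ∀ v → x j ≡ v → Chain _⊏_ A j v
      reach zero len = ⊥-elim (<⇒≱ (x-positive j) (≤-reflexive len))
      reach (suc zero) _ = single j
      reach (suc (suc m)) len with hook-predecessor j len
      ... | k , k<j , xk≡ , h =
        extend k<j (respects (hook h)) (subst (Chain _⊏_ A k) xk≡ (proj₁ (longest-chain k (earlier k<j))))

      -- The last step of a chain comes from some k with x_k < x_j: otherwise t_k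
      -- slices t_j, forcing a_j ⊏ a_k.
      bounded : ∀ m → Chain _⊏_ A j m → m ≤ x j
      bounded _ (single _) = x-positive j
      bounded _ (extend {k} k<j up chain) with x j ≤? x k
      ... | yes drop = ⊥-elim (asym up (respects (slice (x-drop⇒slices k<j drop))))
      ... | no rise  = ≤-<-trans (proj₂ (longest-chain k (earlier k<j)) _ chain) (≰⇒> rise)

-- If T is realised at all, every A increasing along R realises T:
-- the y-half is the x-half for the mirror and the reversed order.
respects⇒realises : ∀ {_⊏_ : Rel ℕ 0ℓ} (order : IsStrictTotalOrder _≡_ _⊏_) {n} (T : Tableau n)
                    (A₀ : Seq n) → Distinct A₀ → Realises _⊏_ A₀ T →
                    (A : Seq n) → (∀ {a b} → R T a b → A a ⊏ A b) → Realises _⊏_ A T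
respects⇒realises {_⊏_} order T A₀ injective₀ real₀ A respects j =
  Extension.longest-chain order T A₀ injective₀ real₀ A respects j (<ᶠ-wellFounded j) ,
  Extension.longest-chain (Flip.isStrictTotalOrder order) (mirror T) A₀ injective₀ (realises-mirror real₀)
    A (respects-mirror {_⊏_ = _⊏_} {A = A} {T} respects) j (<ᶠ-wellFounded j)

-- Reachability from i is decidable for a decidable relation on Fin n along
-- which some measure f strictly increases (recursion on f).
module Reachability {n} {S : Rel (Fin n) 0ℓ} (S? : Decidable S) (f : Fin n → ℕ)
                    (increasing : ∀ {a b} → S a b → f a < f b) (i : Fin n) where

  -- An S-path from i to k, recorded backwards from k.
  Reached : Fin n → Set
  Reached k = Star (flip S) k i

  reached-step : ∀ {a b} → Reached a → S a b → Reached b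
  reached-step ρ s = s ◅ ρ

  reached⇒path : ∀ {a k} → S a k → Reached a → TransClosure S i k
  reached⇒path s ε        = [ s ]
  reached⇒path s (s′ ◅ ρ) = reached⇒path s′ ρ ∷ʳ s

  reached? : ∀ k → Dec (Reached k)
  reached? k = search k (<-wellFounded (f k))
    where
      search : ∀ k → Acc _<_ (f k) → Dec (Reached k)
      search k (acc smaller) with i ≟ᶠ k
      ... | yes refl = yes ε
      ... | no i≢k = map′ (λ (_ , s , ρ) → s ◅ ρ) (λ { ε → ⊥-elim (i≢k refl) ; (s ◅ ρ) → _ , s , ρ })
                          (any? last-step?)
        where
          last-step? : ∀ a → Dec (S a k × Reached a)
          last-step? a with S? a k
          ... | no ¬s = no (¬s ∘ proj₁)
          ... | yes s = map′ (s ,_) proj₂ (search a (smaller (increasing s)))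

module Raise {n} (f : Fin n → ℕ) {U : Fin n → Set} (U? : ∀ k → Dec (U k)) where

  bound : ℕ
  bound = suc (max 0 (tabulate f))

  below-bound : ∀ k → f k < bound
  below-bound k = s≤s (lookup (xs≤max 0 (tabulate f)) (∈-tabulate⁺ k))

  raise : Fin n → ℕ
  raise k with U? k
  ... | yes _ = f k + bound
  ... | no _  = f k

  raise-increasing : ∀ {a b} → f a < f b → (U a → U b) → raise a < raise b
  raise-increasing {a} {b} lt closed with U? a | U? b
  ... | yes _  | yes _  = +-monoˡ-< bound lt
  ... | yes Ua | no ¬Ub = ⊥-elim (¬Ub (closed Ua))
  ... | no _   | yes _  = <-≤-trans lt (m≤m+n (f b) bound)
  ... | no _   | no _   = lt

  raise-separates : ∀ {a b} → ¬ U a → U b → raise a < raise b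
  raise-separates {a} {b} ¬Ua Ub with U? a | U? b
  ... | yes Ua | _      = ⊥-elim (¬Ua Ua)
  ... | no _   | no ¬Ub = ⊥-elim (¬Ub Ub)
  ... | no _   | yes _  = <-≤-trans (below-bound a) (m≤n+m bound (f b))

  raise-injective : Distinct f → Distinct raise
  raise-injective injective {a} {b} same with U? a | U? b
  ... | yes _ | yes _ = injective (+-cancelʳ-≡ bound (f a) (f b) same)
  ... | yes _ | no _  = ⊥-elim (<⇒≱ (below-bound b) (≤-trans (m≤n+m bound (f a)) (≤-reflexive same)))
  ... | no _  | yes _ = ⊥-elim (<⇒≱ (below-bound a) (≤-trans (m≤n+m bound (f b)) (≤-reflexive (sym same))))
  ... | no _  | no _  = injective same

theorem4 : (n : ℕ) (T : Tableau n) → IsESTableau T →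
    (i j : Fin n) → OrderP T i j ⇔ TransClosure (R T) i j
theorem4 n T (A₀ , injective₀ , est₀) i j = mk⇔ order⇒path path⇒order
  where
    increases : ∀ {A} → Distinct A → HasEST A T → ∀ {a b} → R T a b → A a < A b
    increases injective est = R-increases <-isStrictTotalOrder injective (hasEST⇒realises est)

    path⇒order : TransClosure (R T) i j → OrderP T i j
    path⇒order path A injective est = along path
      where
        along : ∀ {a b} → TransClosure (R T) a b → A a < A b
        along [ r ]      = increases injective est r
        along (r ∷ rest) = <-trans (increases injective est r) (along rest)

    open Reachability (R? T) A₀ (increases injective₀ est₀) i
    open Raise A₀ reached?

    -- Raising the points reachable from i keeps R increasing, so T is still realised.
    raise-realises : HasEST raise T
    raise-realises = realises⇒hasEST (respects⇒realises <-isStrictTotalOrder T A₀ injective₀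
      (hasEST⇒realises est₀) raise (λ r → raise-increasing (increases injective₀ est₀ r) (λ ρ → reached-step ρ r)))

    -- If j were not reachable, the raised sequence would put a_j below a_i.
    order⇒path : OrderP T i j → TransClosure (R T) i j
    order⇒path i<j with reached? j
    ... | yes ε        = ⊥-elim (<-irrefl refl (i<j A₀ injective₀ est₀))
    ... | yes (r ◅ ρ)  = reached⇒path r ρ
    ... | no unreached = ⊥-elim (<-asym (i<j raise (raise-injective injective₀) raise-realises)
                                        (raise-separates unreached ε))
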